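{- Let $G$ be a finite simple graph and $k\ge 0$ an integer. The $k$-skeleton of $\Delta(\overrightarrow{G})$ is pure if and only if $k\leqslant |V(G)|-1-r(G)$.
   Context: For a simple graph $G$, $\overrightarrow{G}$ is the directed graph obtained by replacing every edge $xy$ of $G$ by the two directed edges $\overrightarrow{xy}$ and $\overrightarrow{yx}$. For a directed graph $D$, $\Delta(D)$ is the simplicial complex whose vertices are the directed edges of $D$ and whose faces are the edge sets of directed forests (families of vertex-disjoint rooted directed trees) contained in $D$. The $k$-skeleton of a complex consists of its faces of dimension at most $k$; a complex of dimension $k$ is pure if every maximal face has dimension $k$. $N(v)$ is the set of neighbours of $v$ in $G$. A set $A\subseteq V(G)$ is strongly independent if it is independent and $N(u)\cap N(v)=\emptyset$ for all distinct $u,v\in A$; $r(G)$ is the maximum cardinality of a strongly independent subset of $V(G)$. -}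

module Defs where

open import Data.Nat using (ℕ; suc; _+_; _≤_)
open import Data.Fin using (Fin)
open import Data.Bool using (Bool; true; false)
open import Data.Product using (_×_; proj₁; proj₂; Σ; ∃)
open import Data.List using (List; length)
open import Data.List.Membership.Propositional using (_∈_)
open import Data.List.Relation.Binary.Subset.Propositional using (_⊆_)
open import Data.List.Relation.Unary.Unique.Propositional using (Unique)
open import Data.List.Relation.Unary.All using (All)
open import Relation.Binary.PropositionalEquality using (_≡_; _≢_)
open import Relation.Binary.Construct.Closure.Transitive using (TransClosure)
open import Relation.Nullary using (¬_)
open import Function.Bundles using (_⇔_)

record SimpleGraph (n : ℕ) : Set where
  field
    adj    : Fin n → Fin n → Bool
    sym    : ∀ x y → adj x y ≡ adj y x
    irrefl : ∀ x → adj x x ≡ false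

module _ {n : ℕ} (G : SimpleGraph n) where
  open SimpleGraph G

  Adj : Fin n → Fin n → Set
  Adj x y = adj x y ≡ true

  -- Directed edges of G⃗: ordered pairs (x , y) with xy an edge of G.
  DEdge : Set
  DEdge = Fin n × Fin n

  IsDEdge : DEdge → Set
  IsDEdge e = Adj (proj₁ e) (proj₂ e)

  -- A set of directed edges is represented by a duplicate-free list.
  -- F is the edge set of a directed forest (vertex-disjoint rooted trees,
  -- edges oriented away from the roots): every vertex has in-degree ≤ 1
  -- and there is no directed cycle.
  InDegAtMostOne : List DEdge → Set
  InDegAtMostOne F = ∀ x y z → (x , z) ∈ F → (y , z) ∈ F → x ≡ y
    where open Data.Product using (_,_)

  StepIn : List DEdge → Fin n → Fin n → Set
  StepIn F x y = (x , y) ∈ F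
    where open Data.Product using (_,_)

  NoDirectedCycle : List DEdge → Set
  NoDirectedCycle F = ∀ x → ¬ TransClosure (StepIn F) x x

  IsFace : List DEdge → Set
  IsFace F = Unique F × All IsDEdge F × InDegAtMostOne F × NoDirectedCycle F

  -- Faces of the k-skeleton: faces of dimension ≤ k, i.e. with ≤ k+1 elements.
  InSkeleton : ℕ → List DEdge → Set
  InSkeleton k F = IsFace F × length F ≤ suc k

  IsMaximalInSkeleton : ℕ → List DEdge → Set
  IsMaximalInSkeleton k F =
    InSkeleton k F × (∀ F′ → InSkeleton k F′ → F ⊆ F′ → F′ ⊆ F)

  SkeletonPure : ℕ → Set
  SkeletonPure k = ∀ F → IsMaximalInSkeleton k F → length F ≡ suc k

  StronglyIndependent : List (Fin n) → Set
  StronglyIndependent A =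
    Unique A ×
    (∀ u v → u ∈ A → v ∈ A → u ≢ v →
       adj u v ≡ false × (∀ w → ¬ (Adj u w × Adj v w)))

  IsStrongIndepNumber : ℕ → Set
  IsStrongIndepNumber r =
    (Σ (List (Fin n)) λ A → StronglyIndependent A × length A ≡ r) ×
    (∀ A → StronglyIndependent A → length A ≤ r)

module Submission where

-- A face F (the edge list of a directed forest) has in-degrees ≤ 1, so its
-- edges are in bijection with its *targets* (heads of edges); the remaining
-- vertices are its *roots*, and |F| + #roots(F) = n.  Call F *saturated* when
-- no directed edge of G⃗ can be added to it.  Everything rests on two bounds:
--   (lower) the roots of a saturated face are strongly independent, hence
--           n ≤ |F| + r for every saturated face;
--   (upper) starting from the star of a maximum strongly independent set A and
--           adding edges greedily while never entering A, one reaches a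
--           saturated face whose roots contain A, hence |F| + r ≤ n.
-- A face maximal in the k-skeleton is either of size k + 1 or saturated, and a
-- saturated face of size ≤ k + 1 is maximal there.  So purity fails exactly
-- when some saturated face has ≤ k edges, which by (lower) and (upper) happens
-- exactly when n < k + 1 + r.  The greedy search is carried out under double
-- negation, which suffices because the final statement is decidable.

open import Defs
open import Data.Nat using (ℕ; zero; suc; _+_; _≤_; _<_; _≤?_; z≤n; s≤s)
open import Data.Nat.Properties
  using (≤-antisym; ≤-trans; <-≤-trans; ≤-<-trans; <-irrefl; <⇒≱; ≰⇒>; <⇒≤;
         m≤m+n; m≤n+m; +-suc; +-comm; +-identityʳ; +-monoʳ-≤; +-monoˡ-<; +-cancelʳ-<; m≤n⇒m<n∨m≡n)
open import Data.Fin using (Fin)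
open import Data.Fin.Properties using () renaming (_≟_ to _≟ᶠ_)
open import Data.Bool using (true; false)
open import Data.Bool.Properties using () renaming (_≟_ to _≟ᵇ_)
open import Data.Product using (_×_; _,_; proj₁; proj₂; Σ; ∃)
open import Data.Product.Properties using (≡-dec)
open import Data.Sum using (_⊎_; inj₁; inj₂)
open import Data.Empty using (⊥; ⊥-elim)
open import Data.List using (List; []; _∷_; length; map; filter; allFin; cartesianProduct)
open import Data.List.Properties using (length-map; length-tabulate; length-removeAt′)
open import Data.List.Membership.Propositional using (_∈_; _∉_; _─_)
open import Data.List.Membership.Propositional.Properties
  using (∈-map⁺; ∈-map⁻; ∈-filter⁺; ∈-filter⁻; ∈-allFin; ∈-cartesianProduct⁺)
open import Data.List.Membership.DecPropositional using () renaming (_∈?_ to member?)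
open import Data.List.Relation.Unary.Any using (here; there)
open import Data.List.Relation.Unary.All using ([]; _∷_)
import Data.List.Relation.Unary.All as All
open import Data.List.Relation.Unary.AllPairs using ([]; _∷_)
open import Data.List.Relation.Unary.Unique.Propositional using (Unique)
open import Data.List.Relation.Unary.Unique.Propositional.Properties
  using (filter⁺; allFin⁺; cartesianProduct⁺)
open import Data.List.Relation.Binary.Subset.Propositional using (_⊆_)
open import Relation.Binary.PropositionalEquality
  using (_≡_; _≢_; refl; sym; trans; cong; subst; module ≡-Reasoning)
open import Relation.Binary.Construct.Closure.Transitive
  using (TransClosure; [_]; _∷_; _∷ʳ_; _++_)
open import Relation.Nullary using (¬_; Dec; yes; no; ¬?)
open import Relation.Nullary.Decidable using (_×-dec_; ¬¬-excluded-middle; decidable-stable)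
open import Relation.Unary using (Decidable)
open import Function.Bundles using (_⇔_; mk⇔)

module ListCounting {A : Set} where

  ∈-─ : ∀ {x z : A} {ys} (x∈ys : x ∈ ys) → z ∈ ys → x ≢ z → z ∈ ys ─ x∈ys
  ∈-─ (here refl) (here refl) x≢z = ⊥-elim (x≢z refl)
  ∈-─ (here _)    (there z∈)  _   = z∈
  ∈-─ (there _)   (here refl) _   = here refl
  ∈-─ (there x∈)  (there z∈)  x≢z = there (∈-─ x∈ z∈ x≢z)

  unique-⊆⇒length-≤ : ∀ {xs ys : List A} → Unique xs → xs ⊆ ys → length xs ≤ length ys
  unique-⊆⇒length-≤ {[]}     _              _   = z≤n
  unique-⊆⇒length-≤ {x ∷ xs} {ys} (x∉xs ∷ u) xs⊆ys =
    subst (suc (length xs) ≤_) (sym (length-removeAt′ ys _))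
      (s≤s (unique-⊆⇒length-≤ u
        (λ z∈ → ∈-─ x∈ys (xs⊆ys (there z∈)) (All.lookup x∉xs z∈))))
    where x∈ys = xs⊆ys (here refl)

  length-filter+filter-¬ : ∀ {P : A → Set} (P? : Decidable P) xs →
    length (filter P? xs) + length (filter (λ x → ¬? (P? x)) xs) ≡ length xs
  length-filter+filter-¬ P? [] = refl
  length-filter+filter-¬ P? (x ∷ xs) with P? x
  ... | yes _ = cong suc (length-filter+filter-¬ P? xs)
  ... | no  _ = trans (+-suc _ _) (cong suc (length-filter+filter-¬ P? xs))

open ListCounting

module Forests {n : ℕ} (G : SimpleGraph n) where
  open SimpleGraph G using (adj; irrefl) renaming (sym to adj-sym)

  Edge : Set
  Edge = DEdge G

  _≟ᵉ_ : (e e′ : Edge) → Dec (e ≡ e′)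
  _≟ᵉ_ = ≡-dec _≟ᶠ_ _≟ᶠ_

  ¬Adj-self : ∀ {x} → ¬ Adj G x x
  ¬Adj-self {x} a with trans (sym a) (irrefl x)
  ... | ()

  Adj-sym : ∀ {x y} → Adj G x y → Adj G y x
  Adj-sym {x} {y} a = trans (adj-sym y x) a

  Path : List Edge → Fin n → Fin n → Set
  Path F = TransClosure (StepIn G F)

  Reach : List Edge → Fin n → Fin n → Set
  Reach F x y = x ≡ y ⊎ Path F x y

  reach-trans : ∀ {F x y z} → Reach F x y → Reach F y z → Reach F x z
  reach-trans (inj₁ refl) q           = q
  reach-trans (inj₂ p)    (inj₁ refl) = inj₂ p
  reach-trans (inj₂ p)    (inj₂ q)    = inj₂ (p ++ q)

  step-reach : ∀ {F x y z} → StepIn G F x y → Reach F y z → Path F x z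
  step-reach s (inj₁ refl) = [ s ]
  step-reach s (inj₂ p)    = s ∷ p

  path-cons⁻ : ∀ {a b F x y} → Path ((a , b) ∷ F) x y →
    Path F x y ⊎ (Reach F x a × Reach F b y)
  path-cons⁻ [ here refl ] = inj₂ (inj₁ refl , inj₁ refl)
  path-cons⁻ [ there s ]   = inj₁ [ s ]
  path-cons⁻ (here refl ∷ p) with path-cons⁻ p
  ... | inj₁ q        = inj₂ (inj₁ refl , inj₂ q)
  ... | inj₂ (_ , by) = inj₂ (inj₁ refl , by)
  path-cons⁻ (there s ∷ p) with path-cons⁻ p
  ... | inj₁ q         = inj₁ (s ∷ q)
  ... | inj₂ (ya , by) = inj₂ (inj₂ (step-reach s ya) , by)

  path-mono : ∀ {F F′} → F ⊆ F′ → ∀ {x y} → Path F x y → Path F′ x y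
  path-mono F⊆F′ [ s ]   = [ F⊆F′ s ]
  path-mono F⊆F′ (s ∷ p) = F⊆F′ s ∷ path-mono F⊆F′ p

  path-first-edge : ∀ {F x y} → Path F x y → ∃ λ w → (x , w) ∈ F
  path-first-edge [ s ]   = _ , s
  path-first-edge (s ∷ _) = _ , s

  targets : List Edge → List (Fin n)
  targets F = map proj₂ F

  head∈targets : ∀ {F x y} → (x , y) ∈ F → y ∈ targets F
  head∈targets = ∈-map⁺ proj₂

  path-end∈targets : ∀ {F x y} → Path F x y → y ∈ targets F
  path-end∈targets [ s ]   = head∈targets s
  path-end∈targets (_ ∷ p) = path-end∈targets p

  target? : (F : List Edge) → Decidable (_∈ targets F)
  target? F v = member? _≟ᶠ_ v (targets F)

  targetVertices roots : List Edge → List (Fin n)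
  targetVertices F = filter (target? F) (allFin n)
  roots F          = filter (λ v → ¬? (target? F v)) (allFin n)

  root⇒∉targets : ∀ {F v} → v ∈ roots F → v ∉ targets F
  root⇒∉targets {F} m = proj₂ (∈-filter⁻ (λ v → ¬? (target? F v)) {xs = allFin n} m)

  ∉targets⇒root : ∀ {F v} → v ∉ targets F → v ∈ roots F
  ∉targets⇒root {F} {v} = ∈-filter⁺ (λ v → ¬? (target? F v)) (∈-allFin v)

  targets-unique : ∀ {F} → Unique F → InDegAtMostOne G F → Unique (targets F)
  targets-unique {[]} _ _ = []
  targets-unique {(x , z) ∷ F} (e∉F ∷ u) indeg =
    All.tabulate z≢ ∷ targets-unique u (λ x y z p q → indeg x y z (there p) (there q))
    where
    z≢ : ∀ {t} → t ∈ targets F → z ≢ t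
    z≢ t∈ refl with ∈-map⁻ proj₂ t∈
    ... | (y , _) , e∈F , refl with indeg x y z (here refl) (there e∈F)
    ... | refl = All.lookup e∉F e∈F refl

  face-length+roots : ∀ {F} → IsFace G F → length F + length (roots F) ≡ n
  face-length+roots {F} (uniq , _ , indeg , _) = begin
    length F + length (roots F)                      ≡⟨ cong (_+ length (roots F)) #targets ⟩
    length (targetVertices F) + length (roots F)     ≡⟨ length-filter+filter-¬ (target? F) (allFin n) ⟩
    length (allFin n)                                ≡⟨ length-tabulate (λ x → x) ⟩
    n                                                ∎
    where
    open ≡-Reasoning
    #targets : length F ≡ length (targetVertices F)
    #targets = ≤-antisym
      (subst (_≤ length (targetVertices F)) (length-map proj₂ F)
        (unique-⊆⇒length-≤ (targets-unique uniq indeg)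
          (λ {v} → ∈-filter⁺ (target? F) (∈-allFin v))))
      (subst (length (targetVertices F) ≤_) (length-map proj₂ F)
        (unique-⊆⇒length-≤ (filter⁺ (target? F) (allFin⁺ n))
          (λ m → proj₂ (∈-filter⁻ (target? F) {xs = allFin n} m))))

  face-length-≤ : ∀ {F} → IsFace G F → length F ≤ n
  face-length-≤ {F} face = subst (length F ≤_) (face-length+roots face) (m≤m+n _ _)

  face-extend : ∀ {F a b} → IsFace G F → Adj G a b → b ∉ targets F → ¬ Reach F b a →
    IsFace G ((a , b) ∷ F)
  face-extend {F} {a} {b} (uniq , edges , indeg , acyclic) ab b-root b↛a =
    (All.tabulate new ∷ uniq) , (ab ∷ edges) , indeg′ , acyclic′
    where
    new : ∀ {e} → e ∈ F → (a , b) ≢ e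
    new e∈F refl = b-root (head∈targets e∈F)
    indeg′ : InDegAtMostOne G ((a , b) ∷ F)
    indeg′ x y z (here refl) (here refl) = refl
    indeg′ x y z (here refl) (there q)   = ⊥-elim (b-root (head∈targets q))
    indeg′ x y z (there p)   (here refl) = ⊥-elim (b-root (head∈targets p))
    indeg′ x y z (there p)   (there q)   = indeg x y z p q
    acyclic′ : NoDirectedCycle G ((a , b) ∷ F)
    acyclic′ x c with path-cons⁻ c
    ... | inj₁ p        = acyclic x p
    ... | inj₂ (xa , bx) = b↛a (reach-trans bx xa)

  face-⊆ : ∀ {F F′} → Unique F → F ⊆ F′ → IsFace G F′ → IsFace G F
  face-⊆ uniq F⊆F′ (_ , edges , indeg , acyclic) =
    uniq , All.tabulate (λ m → All.lookup edges (F⊆F′ m)) ,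
    (λ x y z p q → indeg x y z (F⊆F′ p) (F⊆F′ q)) ,
    (λ x c → acyclic x (path-mono F⊆F′ c))

  Saturated : List Edge → Set
  Saturated F = ∀ e → IsDEdge G e → e ∉ F → ¬ IsFace G (e ∷ F)

  -- Paths read backwards, to follow the unique in-edges towards a root.
  BackPath : List Edge → Fin n → Fin n → Set
  BackPath F = TransClosure (λ y x → StepIn G F x y)

  reverse : ∀ {F x y} → Path F x y → BackPath F y x
  reverse [ s ]   = [ s ]
  reverse (s ∷ p) = reverse p ∷ʳ s

  backPath-start∈targets : ∀ {F x y} → BackPath F y x → y ∈ targets F
  backPath-start∈targets [ s ]   = head∈targets s
  backPath-start∈targets (s ∷ _) = head∈targets s

  root-ancestor-unique : ∀ {F u v w} → InDegAtMostOne G F → u ∉ targets F → v ∉ targets F →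
    Path F u w → Path F v w → u ≡ v
  root-ancestor-unique {F} indeg u-root v-root p q = back u-root v-root (reverse p) (reverse q)
    where
    back : ∀ {u v w} → u ∉ targets F → v ∉ targets F → BackPath F w u → BackPath F w v → u ≡ v
    back _ _ [ s ] [ s′ ] = indeg _ _ _ s s′
    back u-root _ [ s ] (s′ ∷ q) with indeg _ _ _ s s′
    ... | refl = ⊥-elim (u-root (backPath-start∈targets q))
    back _ v-root (s ∷ p) [ s′ ] with indeg _ _ _ s s′
    ... | refl = ⊥-elim (v-root (backPath-start∈targets p))
    back u-root v-root (s ∷ p) (s′ ∷ q) with indeg _ _ _ s s′
    ... | refl = back u-root v-root p q

  module _ {F : List Edge} (face : IsFace G F) (saturated : Saturated F) where

    -- Two distinct roots of a saturated face are not adjacent: the edge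
    -- between them could be added.
    saturated-roots-nonadjacent : ∀ {u v} → u ∉ targets F → v ∉ targets F → u ≢ v →
      ¬ Adj G u v
    saturated-roots-nonadjacent {u} {v} u-root v-root u≢v uv =
      saturated (u , v) uv (λ m → v-root (head∈targets m)) (face-extend face uv v-root v↛u)
      where
      v↛u : ¬ Reach F v u
      v↛u (inj₁ v≡u) = u≢v (sym v≡u)
      v↛u (inj₂ p)   = u-root (path-end∈targets p)

    -- A root of a saturated face reaches each of its neighbours: otherwise the
    -- edge from the neighbour into the root could be added.
    saturated-root-reaches : ∀ {u w} → u ∉ targets F → Adj G u w → ¬ ¬ Path F u w
    saturated-root-reaches {u} {w} u-root uw u↛w =
      saturated (w , u) wu (λ m → u-root (head∈targets m)) (face-extend face wu u-root u↛w′)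
      where
      wu = Adj-sym uw
      u↛w′ : ¬ Reach F u w
      u↛w′ (inj₁ refl) = ¬Adj-self uw
      u↛w′ (inj₂ p)    = u↛w p

    saturated-roots-stronglyIndependent : StronglyIndependent G (roots F)
    saturated-roots-stronglyIndependent =
      filter⁺ (λ v → ¬? (target? F v)) (allFin⁺ n) , separated
      where
      separated : ∀ u v → u ∈ roots F → v ∈ roots F → u ≢ v →
        adj u v ≡ false × (∀ w → ¬ (Adj G u w × Adj G v w))
      separated u v u∈ v∈ u≢v = nonadjacent , noCommonNeighbour
        where
        u-root = root⇒∉targets u∈
        v-root = root⇒∉targets v∈
        nonadjacent : adj u v ≡ false
        nonadjacent with adj u v in uv
        ... | true  = ⊥-elim (saturated-roots-nonadjacent u-root v-root u≢v uv)
        ... | false = refl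
        noCommonNeighbour : ∀ w → ¬ (Adj G u w × Adj G v w)
        noCommonNeighbour w (uw , vw) =
          saturated-root-reaches u-root uw λ p →
          saturated-root-reaches v-root vw λ q →
          u≢v (root-ancestor-unique (proj₁ (proj₂ (proj₂ face))) u-root v-root p q)

    saturated-lower-bound : ∀ {r} → IsStrongIndepNumber G r → n ≤ length F + r
    saturated-lower-bound {r} (_ , maximum) =
      subst (_≤ length F + r) (face-length+roots face)
        (+-monoʳ-≤ (length F) (maximum (roots F) saturated-roots-stronglyIndependent))

  Rooted : List (Fin n) → List Edge → Set
  Rooted A F = IsFace G F × (∀ a y → a ∈ A → Adj G a y → (a , y) ∈ F) × (∀ a → a ∈ A → a ∉ targets F)

  -- Adding any edge to a rooted face keeps it rooted: an edge x → a with
  -- a ∈ A would close the cycle a → x → a.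
  rooted-extend : ∀ {A F e} → Rooted A F → IsFace G (e ∷ F) → Rooted A (e ∷ F)
  rooted-extend {A} {F} {x , y} (_ , out , A-roots) face′ =
    face′ , (λ a y′ a∈ ay′ → there (out a y′ a∈ ay′)) , A-roots′
    where
    A-roots′ : ∀ a → a ∈ A → a ∉ targets ((x , y) ∷ F)
    A-roots′ a a∈ (there m) = A-roots a a∈ m
    A-roots′ a a∈ (here refl) =
      proj₂ (proj₂ (proj₂ face′)) a
        (there (out a x a∈ (Adj-sym (All.lookup (proj₁ (proj₂ face′)) (here refl)))) ∷ [ here refl ])

  -- Greedy saturation: a rooted face extends to a saturated rooted face.
  -- The fuel m bounds the number of edges still addable (faces have ≤ n edges).
  saturate : ∀ {A} m F → n ≤ length F + m → Rooted A F →
    ¬ ¬ (Σ (List Edge) λ F′ → Rooted A F′ × Saturated F′)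
  saturate zero F full rooted done = done (F , rooted , noRoom)
    where
    noRoom : Saturated F
    noRoom _ _ _ face′ = <-irrefl refl
      (≤-trans (face-length-≤ face′) (subst (n ≤_) (+-identityʳ (length F)) full))
  saturate (suc m) F full rooted done =
    ¬¬-excluded-middle {A = Σ Edge λ e → IsDEdge G e × e ∉ F × IsFace G (e ∷ F)} step
    where
    step : Dec (Σ Edge λ e → IsDEdge G e × e ∉ F × IsFace G (e ∷ F)) → ⊥
    step (yes (e , _ , _ , face′)) =
      saturate m (e ∷ F) (subst (n ≤_) (+-suc _ _) full) (rooted-extend rooted face′) done
    step (no stuck) = done (F , rooted , λ e de e∉ face′ → stuck (e , de , e∉ , face′))

  module Star (A : List (Fin n)) (A-indep : StronglyIndependent G A) where
    Leaves : Edge → Set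
    Leaves (x , y) = x ∈ A × Adj G x y

    leaves? : Decidable Leaves
    leaves? (x , y) = member? _≟ᶠ_ x A ×-dec (adj x y ≟ᵇ true)

    star : List Edge
    star = filter leaves? (cartesianProduct (allFin n) (allFin n))

    ∈-star⁻ : ∀ {e} → e ∈ star → Leaves e
    ∈-star⁻ m = proj₂ (∈-filter⁻ leaves? {xs = cartesianProduct (allFin n) (allFin n)} m)

    neighbour∉A : ∀ {a y} → a ∈ A → Adj G a y → y ∉ A
    neighbour∉A {a} {y} a∈ ay y∈ with a ≟ᶠ y
    ... | yes refl = ¬Adj-self ay
    ... | no a≢y with trans (sym ay) (proj₁ (proj₂ A-indep a y a∈ y∈ a≢y))
    ... | ()

    star-face : IsFace G star
    star-face =
      filter⁺ leaves? (cartesianProduct⁺ (allFin⁺ n) (allFin⁺ n)) ,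
      All.tabulate (λ m → proj₂ (∈-star⁻ m)) , indeg , acyclic
      where
      -- Two edges into z from A would make z a common neighbour.
      indeg : InDegAtMostOne G star
      indeg x y z p q with x ≟ᶠ y
      ... | yes x≡y = x≡y
      ... | no x≢y = ⊥-elim (proj₂ (proj₂ A-indep x y (proj₁ (∈-star⁻ p)) (proj₁ (∈-star⁻ q)) x≢y) z
                               (proj₂ (∈-star⁻ p) , proj₂ (∈-star⁻ q)))
      -- No path has two steps: edge heads lie outside A, edge tails inside.
      acyclic : NoDirectedCycle G star
      acyclic x [ s ]   = ¬Adj-self (proj₂ (∈-star⁻ s))
      acyclic x (s ∷ p) = neighbour∉A (proj₁ (∈-star⁻ s)) (proj₂ (∈-star⁻ s))
                            (proj₁ (∈-star⁻ (proj₂ (path-first-edge p))))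

    star-rooted : Rooted A star
    star-rooted = star-face , out , A-roots
      where
      out : ∀ a y → a ∈ A → Adj G a y → (a , y) ∈ star
      out a y a∈ ay = ∈-filter⁺ leaves? (∈-cartesianProduct⁺ (∈-allFin a) (∈-allFin y)) (a∈ , ay)
      A-roots : ∀ a → a ∈ A → a ∉ targets star
      A-roots a a∈ m with ∈-map⁻ proj₂ m
      ... | _ , e∈ , refl = neighbour∉A (proj₁ (∈-star⁻ e∈)) (proj₂ (∈-star⁻ e∈)) a∈

  small-saturated-face : ∀ {r} → IsStrongIndepNumber G r →
    ¬ ¬ (Σ (List Edge) λ F → IsFace G F × Saturated F × length F + r ≤ n)
  small-saturated-face {r} ((A , A-indep , |A|≡r) , _) found =
    saturate n star (m≤n+m n _) star-rooted λ (F , (face , _ , A-roots) , saturated) →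
      found (F , face , saturated ,
        subst (length F + r ≤_) (face-length+roots face)
          (+-monoʳ-≤ (length F) (subst (_≤ length (roots F)) |A|≡r
            (unique-⊆⇒length-≤ (proj₁ A-indep) (λ {a} a∈ → ∉targets⇒root (A-roots a a∈))))))
    where open Star A A-indep

  saturated⇒maximal : ∀ {F k} → IsFace G F → Saturated F → length F ≤ suc k →
    IsMaximalInSkeleton G k F
  saturated⇒maximal {F} {k} face saturated short = (face , short) , maximal
    where
    maximal : ∀ F′ → InSkeleton G k F′ → F ⊆ F′ → F′ ⊆ F
    maximal F′ (face′ , _) F⊆F′ {e} e∈F′ with member? _≟ᵉ_ e F
    ... | yes e∈F = e∈F
    ... | no  e∉F = ⊥-elim (saturated e (All.lookup (proj₁ (proj₂ face′)) e∈F′) e∉F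
      (face-⊆ (All.tabulate (λ m e≡ → e∉F (subst (_∈ F) (sym e≡) m)) ∷ proj₁ face)
        (λ { (here refl) → e∈F′ ; (there m) → F⊆F′ m }) face′))

  maximal-short⇒saturated : ∀ {F k} → IsMaximalInSkeleton G k F → length F < suc k →
    Saturated F
  maximal-short⇒saturated {F} (_ , maximal) short e _ e∉F face′ =
    e∉F (maximal (e ∷ F) (face′ , short) there (here refl))

mainTheorem5 : (n : ℕ) (G : SimpleGraph n) (r : ℕ) → IsStrongIndepNumber G r →
    (k : ℕ) → SkeletonPure G k ⇔ (k + 1 + r ≤ n)
mainTheorem5 n G r isr k = mk⇔ pure⇒bound bound⇒pure
  where
  open Forests G
  k+1≡1+k : k + 1 + r ≡ suc k + r
  k+1≡1+k = cong (_+ r) (+-comm k 1)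

  -- If n < k + 1 + r, a saturated face with ≤ n − r ≤ k edges is maximal but short.
  pure⇒bound : SkeletonPure G k → k + 1 + r ≤ n
  pure⇒bound pure = decidable-stable (k + 1 + r ≤? n) λ ¬bound →
    small-saturated-face isr λ (F , face , saturated , small) →
      let short : length F < suc k
          short = +-cancelʳ-< r (length F) (suc k)
                    (subst (length F + r <_) k+1≡1+k (≤-<-trans small (≰⇒> ¬bound)))
      in <-irrefl (pure F (saturated⇒maximal face saturated (<⇒≤ short))) short

  -- A short maximal face would be saturated, contradicting the lower bound.
  bound⇒pure : k + 1 + r ≤ n → SkeletonPure G k
  bound⇒pure bound F maximal with m≤n⇒m<n∨m≡n (proj₂ (proj₁ maximal))
  ... | inj₂ full  = full
  ... | inj₁ short = ⊥-elim (<⇒≱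
    (<-≤-trans (+-monoˡ-< r short) (subst (_≤ n) k+1≡1+k bound))
    (saturated-lower-bound (proj₁ (proj₁ maximal)) (maximal-short⇒saturated maximal short) isr))
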